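{- Let $G$ be a graph, $k$ an integer, $S\subseteq V(G)$, and let $\mathcal{C}$ be the set of all inclusion-wise maximal chips with respect to $S$ and $k$. Then any chip $C\in\mathcal{C}$ touches at most $3k\cdot 4^{3k}$ other chips of $\mathcal{C}$.
   Context: $N(C)$ denotes the set of vertices outside $C$ adjacent to $C$. A set $W$ is an $X$–$Y$ separator if no component of $G\setminus W$ contains a vertex of $X$ and a vertex of $Y$. $R_H(A)$ is the set of vertices reachable from $A$ in $H$. An inclusion-wise minimal $X$–$Y$ separator $W$ is important if there is no $X$–$Y$ separator $W'$ with $|W'|\le|W|$ and $R_{G\setminus W}(X\setminus W)\subsetneq R_{G\setminus W'}(X\setminus W')$. A chip (for $S$, $k$) is a set $C\subseteq V(G)$ with $G[C]$ connected, $|N(C)|\le 3k$, and $N(C)$ an important $C$–$S$ separator. Two chips $C_1\ne C_2$ touch if $C_1\cap C_2\neq\emptyset$ or there is an edge between $C_1$ and $C_2$. -}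

module Defs where

open import Data.Nat using (ℕ; _≤_; _*_; _^_)
open import Data.Bool using (Bool; true; false)
open import Data.Fin using (Fin)
open import Data.Fin.Subset using (Subset; _∈_; _∉_; _⊆_; ∣_∣; ∁)
open import Data.Product using (Σ; ∃; _×_; _,_)
open import Data.Sum using (_⊎_)
open import Data.List using (List; length)
open import Data.List.Relation.Unary.All using (All)
open import Data.List.Relation.Unary.Unique.Propositional using (Unique)
open import Relation.Nullary using (¬_)
open import Relation.Binary.PropositionalEquality using (_≡_; _≢_)

record Graph : Set where
  field
    n     : ℕ
    adj   : Fin n → Fin n → Bool
    sym   : ∀ u v → adj u v ≡ adj v u
    irrefl : ∀ v → adj v v ≡ false

module _ (G : Graph) where
  open Graph G

  Vertex : Set
  Vertex = Fin n

  VSet : Set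
  VSet = Subset n

  Edge : Vertex → Vertex → Set
  Edge u v = adj u v ≡ true

  data Walk (W : VSet) : Vertex → Vertex → Set where
    here : ∀ {v} → v ∉ W → Walk W v v
    step : ∀ {u v w} → u ∉ W → Edge u v → Walk W v w → Walk W u w

  InN : VSet → Vertex → Set
  InN C v = v ∉ C × ∃ λ u → u ∈ C × Edge u v

  IsNbhd : VSet → VSet → Set
  IsNbhd C W = ∀ v → (v ∈ W → InN C v) × (InN C v → v ∈ W)

  Separator : VSet → VSet → VSet → Set
  Separator X Y W = ∀ x y → x ∈ X → y ∈ Y → ¬ Walk W x y

  Reach : VSet → VSet → Vertex → Set
  Reach X W v = ∃ λ x → x ∈ X × Walk W x v

  _⊂_ : VSet → VSet → Set
  A ⊂ B = A ⊆ B × A ≢ B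

  MinimalSeparator : VSet → VSet → VSet → Set
  MinimalSeparator X Y W =
    Separator X Y W × (∀ W' → W' ⊂ W → ¬ Separator X Y W')

  StrictlyMoreReach : VSet → VSet → VSet → Set
  StrictlyMoreReach X W W' =
    (∀ v → Reach X W v → Reach X W' v) × (∃ λ v → Reach X W' v × ¬ Reach X W v)

  ImportantSeparator : VSet → VSet → VSet → Set
  ImportantSeparator X Y W =
    MinimalSeparator X Y W ×
    (∀ W' → Separator X Y W' → ∣ W' ∣ ≤ ∣ W ∣ → ¬ StrictlyMoreReach X W W')

  Connected : VSet → Set
  Connected C = (∃ λ v → v ∈ C) × (∀ u v → u ∈ C → v ∈ C → Walk (∁ C) u v)

  Chip : VSet → ℕ → VSet → Set
  Chip S k C = Connected C × (∀ W → IsNbhd C W →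
                 (∣ W ∣ ≤ 3 * k) × ImportantSeparator C S W)

  MaximalChip : VSet → ℕ → VSet → Set
  MaximalChip S k C = Chip S k C × (∀ C' → Chip S k C' → C ⊆ C' → C ≡ C')

  Touch : VSet → VSet → Set
  Touch C₁ C₂ = C₁ ≢ C₂ ×
    ((∃ λ v → v ∈ C₁ × v ∈ C₂) ⊎ (∃ λ u → ∃ λ v → u ∈ C₁ × v ∈ C₂ × Edge u v))

-- Every chip touching C contains a vertex of N(C), and |N(C)| ≤ 3k. A chip C' through a
-- vertex v is the component of v in G ∖ N(C'), so it is determined by N(C'), which is an
-- important v–S separator of size at most 3k. There are at most 4^b important separators of
-- size at most b: take a vertex u just beyond the furthest minimum separator; either u lies in
-- the important separator, or u can be moved to the source side, which by submodularity of
-- |N(·)| strictly increases the minimum separator size. Both branches decrease 2b − λ − |D|,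
-- where λ is the minimum size and D the set of vertices forced into the separator.
module Submission where

open import Defs
open import Data.Bool using (true)
open import Data.Bool.Properties using () renaming (_≟_ to _≟ᵇ_)
open import Data.Empty using (⊥-elim)
open import Data.Fin using (Fin; zero; suc)
open import Data.Fin.Properties using (any?; all?) renaming (_≟_ to _≟ᶠ_)
open import Data.Fin.Subset using (Subset; _∈_; _∉_; _⊆_; _⊃_; _∪_; _∩_; ⁅_⁆; ∣_∣; ⊥; inside; outside)
open import Data.Fin.Subset.Induction using (⊃-wellFounded)
open import Data.Fin.Subset.Properties
  using ( _∈?_; _⊆?_; anySubset?; p⊆q⇒∣p∣≤∣q∣; p⊂q⇒∣p∣<∣q∣; ∣p∣≤n; ⊆-antisym; ⊆-min; drop-there; p⊆p∪q
        ; q⊆p∪q; x∈p∪q⁺; x∈p∪q⁻; x∈p∩q⁺; x∈p∩q⁻; x∈⁅x⁆; x∈⁅y⁆⇒x≡y; x∉∁p⇒x∈p; x∉p⇒x∈∁p )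
open import Data.List using (List; []; _∷_; length; map; filter)
open import Data.List.Membership.Propositional using () renaming (_∈_ to _∈ₗ_)
open import Data.List.Membership.Propositional.Properties using (∈-map⁺)
open import Data.List.Properties using (length-map)
open import Data.List.Relation.Unary.All as All using (All; []; _∷_)
open import Data.List.Relation.Unary.All.Properties using (all-filter) renaming (filter⁺ to All-filter⁺; map⁺ to All-map⁺)
open import Data.List.Relation.Unary.Any as Any using (Any; here; there)
open import Data.List.Relation.Unary.AllPairs using ([]; _∷_)
open import Data.List.Relation.Unary.Unique.Propositional using (Unique)
open import Data.List.Relation.Unary.Unique.Propositional.Properties using () renaming (filter⁺ to Unique-filter⁺)
open import Data.Nat using (ℕ; zero; suc; _+_; _*_; _^_; _∸_; _≤_; _<_; _<?_; _≤?_; z≤n; s≤s)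
open import Data.Nat.Induction using (<-wellFounded)
open import Data.Nat.Properties
  using ( ≤-refl; ≤-trans; ≤-reflexive; <-≤-trans; ≮⇒≥; <⇒≱; +-suc; +-identityʳ; +-mono-≤; +-monoʳ-≤
        ; +-monoˡ-≤; +-mono-≤-<; +-cancelʳ-≤; ∸-monoʳ-<; m≤m+n; *-monoˡ-≤; m^n>0; ^-*-assoc )
open import Data.Product using (∃; _×_; _,_; proj₁; proj₂; map₁)
open import Data.Sum using (_⊎_; inj₁; inj₂; [_,_]′; map₂)
open import Data.Vec using ([]; _∷_; tabulate)
open import Data.Vec.Properties using (≡-dec; lookup∘tabulate; []=⇒lookup; lookup⇒[]=)
open import Function using (_∘_; id)
open import Induction.WellFounded using (Acc; acc)
open import Level using (0ℓ)
open import Relation.Nullary using (Dec; yes; no; does; ¬_; contradiction)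
open import Relation.Nullary.Decidable using (map′; _×-dec_; _⊎-dec_; _→-dec_; ¬?)
open import Relation.Unary using (Pred; Decidable)
open import Relation.Unary.Properties using (∁?)
open import Relation.Binary.PropositionalEquality using (_≡_; _≢_; refl; sym; trans; cong; subst; subst₂)

private
  variable
    m : ℕ

⟦_⟧ : {P : Pred (Fin m) 0ℓ} → Decidable P → Subset m
⟦ P? ⟧ = tabulate (does ∘ P?)

module _ {P : Pred (Fin m) 0ℓ} (P? : Decidable P) where

  ∈⟦⟧⁺ : ∀ {x} → P x → x ∈ ⟦ P? ⟧
  ∈⟦⟧⁺ {x} px with P? x in eq
  ... | yes _ = lookup⇒[]= x _ (trans (lookup∘tabulate (does ∘ P?) x) (cong does eq))
  ... | no ¬px = contradiction px ¬px

  ∈⟦⟧⁻ : ∀ {x} → x ∈ ⟦ P? ⟧ → P x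
  ∈⟦⟧⁻ {x} x∈ with P? x | trans (sym (lookup∘tabulate (does ∘ P?) x)) ([]=⇒lookup x∈)
  ... | yes px | _  = px
  ... | no _   | ()

∣p∪q∣+∣p∩q∣≡∣p∣+∣q∣ : ∀ (p q : Subset m) → ∣ p ∪ q ∣ + ∣ p ∩ q ∣ ≡ ∣ p ∣ + ∣ q ∣
∣p∪q∣+∣p∩q∣≡∣p∣+∣q∣ []            []            = refl
∣p∪q∣+∣p∩q∣≡∣p∣+∣q∣ (outside ∷ p) (outside ∷ q) = ∣p∪q∣+∣p∩q∣≡∣p∣+∣q∣ p q
∣p∪q∣+∣p∩q∣≡∣p∣+∣q∣ (inside ∷ p)  (outside ∷ q) = cong suc (∣p∪q∣+∣p∩q∣≡∣p∣+∣q∣ p q)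
∣p∪q∣+∣p∩q∣≡∣p∣+∣q∣ (outside ∷ p) (inside ∷ q)  =
  trans (cong suc (∣p∪q∣+∣p∩q∣≡∣p∣+∣q∣ p q)) (sym (+-suc ∣ p ∣ ∣ q ∣))
∣p∪q∣+∣p∩q∣≡∣p∣+∣q∣ (inside ∷ p)  (inside ∷ q)  =
  cong suc (trans (+-suc ∣ p ∪ q ∣ ∣ p ∩ q ∣)
                  (trans (cong suc (∣p∪q∣+∣p∩q∣≡∣p∣+∣q∣ p q)) (sym (+-suc ∣ p ∣ ∣ q ∣))))

∣p∣+∣q∣≤∣r∣+∣s∣ : ∀ {p q r s : Subset m} → p ∪ q ⊆ r ∪ s → p ∩ q ⊆ r ∩ s →
                  ∣ p ∣ + ∣ q ∣ ≤ ∣ r ∣ + ∣ s ∣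
∣p∣+∣q∣≤∣r∣+∣s∣ {p = p} {q} {r} {s} ∪⊆ ∩⊆ =
  subst₂ _≤_ (∣p∪q∣+∣p∩q∣≡∣p∣+∣q∣ p q) (∣p∪q∣+∣p∩q∣≡∣p∣+∣q∣ r s)
    (+-mono-≤ (p⊆q⇒∣p∣≤∣q∣ ∪⊆) (p⊆q⇒∣p∣≤∣q∣ ∩⊆))

p⊈q⇒∃∉ : ∀ {p q : Subset m} → ¬ p ⊆ q → ∃ λ v → v ∈ p × v ∉ q
p⊈q⇒∃∉ {p = p} {q} p⊈q with any? (λ v → v ∈? p ×-dec ¬? (v ∈? q))
... | yes found = found
... | no none   = ⊥-elim (p⊈q p⊆q)
  where
  p⊆q : p ⊆ q
  p⊆q {v} v∈p with v ∈? q
  ... | yes v∈q = v∈q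
  ... | no v∉q  = contradiction (v , v∈p , v∉q) none

p⊆q∧p≢q⇒∣p∣<∣q∣ : ∀ {p q : Subset m} → p ⊆ q → p ≢ q → ∣ p ∣ < ∣ q ∣
p⊆q∧p≢q⇒∣p∣<∣q∣ p⊆q p≢q = p⊂q⇒∣p∣<∣q∣ (p⊆q , p⊈q⇒∃∉ (λ q⊆p → p≢q (⊆-antisym p⊆q q⊆p)))

x∈p∪⁅x⁆ : ∀ {p : Subset m} {x} → x ∈ p ∪ ⁅ x ⁆
x∈p∪⁅x⁆ {p = p} {x} = q⊆p∪q p ⁅ x ⁆ (x∈⁅x⁆ x)

x∈p∪⁅y⁆⁻ : ∀ {p : Subset m} {x y} → x ∈ p ∪ ⁅ y ⁆ → x ∈ p ⊎ x ≡ y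
x∈p∪⁅y⁆⁻ {p = p} {y = y} = map₂ (x∈⁅y⁆⇒x≡y y) ∘ x∈p∪q⁻ p ⁅ y ⁆

module _ {P : Pred (Subset m) 0ℓ} (P? : Decidable P) where

  minimum-by : (f : Subset m → ℕ) → ∀ {W₀} → P W₀ → ∃ λ W → P W × ∀ W' → P W' → f W ≤ f W'
  minimum-by f {W₀} pW₀ = descend W₀ pW₀ (<-wellFounded (f W₀))
    where
    descend : ∀ W → P W → Acc _<_ (f W) → ∃ λ W → P W × ∀ W' → P W' → f W ≤ f W'
    descend W pW (acc smaller) with anySubset? (λ W' → P? W' ×-dec f W' <? f W)
    ... | yes (W' , pW' , lt) = descend W' pW' (smaller lt)
    ... | no none = W , pW , λ W' pW' → ≮⇒≥ (λ lt → none (W' , pW' , lt))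

  maximum-by : (f : Subset m → ℕ) {B : ℕ} → (∀ W → f W ≤ B) → ∀ {W₀} → P W₀ →
               ∃ λ W → P W × ∀ W' → P W' → f W' ≤ f W
  maximum-by f {B} f≤B pW₀ with minimum-by (λ W → B ∸ f W) pW₀
  ... | W , pW , least = W , pW , λ W' pW' →
    ≮⇒≥ (λ lt → <⇒≱ (∸-monoʳ-< lt (f≤B W')) (least W' pW'))

module _ {A : Set} {P : Pred A 0ℓ} (P? : Decidable P) where

  all-filter-× : ∀ {Q : Pred A 0ℓ} {xs} → All Q xs → All (λ x → Q x × P x) (filter P? xs)
  all-filter-× {xs = xs} all = All.zip (All-filter⁺ P? all , all-filter P? xs)

  length-filter+length-filter-∁ : ∀ (xs : List A) →
    length (filter P? xs) + length (filter (∁? P?) xs) ≡ length xs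
  length-filter+length-filter-∁ [] = refl
  length-filter+length-filter-∁ (x ∷ xs) with P? x
  ... | yes _ = cong suc (length-filter+length-filter-∁ xs)
  ... | no _  = trans (+-suc _ _) (cong suc (length-filter+length-filter-∁ xs))

Unique∧All≡⇒length≤1 : {A : Set} {a : A} {xs : List A} → Unique xs → All (_≡ a) xs → length xs ≤ 1
Unique∧All≡⇒length≤1 {xs = []}         _                 _                = z≤n
Unique∧All≡⇒length≤1 {xs = _ ∷ []}     _                 _                = s≤s z≤n
Unique∧All≡⇒length≤1 {xs = _ ∷ _ ∷ _} ((x≢y ∷ _) ∷ _) (x≡a ∷ y≡a ∷ _) = contradiction (trans x≡a (sym y≡a)) x≢y

Unique-map⁺-on : {A B : Set} {P : Pred A 0ℓ} {f : A → B} →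
  (∀ {x y} → P x → P y → f x ≡ f y → x ≡ y) →
  ∀ {xs} → All P xs → Unique xs → Unique (map f xs)
Unique-map⁺-on inj [] [] = []
Unique-map⁺-on {P = P} {f} inj {x ∷ xs} (px ∷ pxs) (x∉xs ∷ u) = apart pxs x∉xs ∷ Unique-map⁺-on inj pxs u
  where
  apart : ∀ {ys} → All P ys → All (λ y → ¬ x ≡ y) ys → All (λ z → ¬ f x ≡ z) (map f ys)
  apart []         []         = []
  apart (py ∷ pys) (x≢y ∷ ne) = (x≢y ∘ inj px py) ∷ apart pys ne

module _ {A V : Set} {_∋_ : A → V → Set} (_∋?_ : ∀ a v → Dec (a ∋ v)) {P : Pred A 0ℓ} {B : ℕ}
         (bounded : ∀ v {L} → Unique L → All (λ a → P a × a ∋ v) L → length L ≤ B) where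

  length≤covering*bound : ∀ (vs : List V) {L} → Unique L →
    All (λ a → P a × Any (a ∋_) vs) L → length L ≤ length vs * B
  length≤covering*bound [] {[]} _ _ = z≤n
  length≤covering*bound [] {_ ∷ _} _ ((_ , ()) ∷ _)
  length≤covering*bound (v ∷ vs) {L} u all =
    subst (_≤ B + length vs * B) (length-filter+length-filter-∁ (_∋? v) L)
      (+-mono-≤ (bounded v (Unique-filter⁺ (_∋? v) u) (All.map at-v (all-filter-× (_∋? v) all)))
                (length≤covering*bound vs (Unique-filter⁺ (∁? (_∋? v)) u)
                  (All.map later (all-filter-× (∁? (_∋? v)) all))))
    where
    at-v : ∀ {a} → (P a × Any (a ∋_) (v ∷ vs)) × a ∋ v → P a × a ∋ v
    at-v ((pa , _) , a∋v) = pa , a∋v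
    later : ∀ {a} → (P a × Any (a ∋_) (v ∷ vs)) × ¬ a ∋ v → P a × Any (a ∋_) vs
    later ((pa , here a∋v)  , a∌v) = contradiction a∋v a∌v
    later ((pa , there any) , _)   = pa , any

elements : Subset m → List (Fin m)
elements []            = []
elements (inside ∷ p)  = zero ∷ map suc (elements p)
elements (outside ∷ p) = map suc (elements p)

length-elements : ∀ (p : Subset m) → length (elements p) ≡ ∣ p ∣
length-elements []            = refl
length-elements (inside ∷ p)  = cong suc (trans (length-map suc (elements p)) (length-elements p))
length-elements (outside ∷ p) = trans (length-map suc (elements p)) (length-elements p)

∈-elements : ∀ {p : Subset m} {x} → x ∈ p → x ∈ₗ elements p
∈-elements {p = inside ∷ p}  {zero}  _   = here refl
∈-elements {p = inside ∷ p}  {suc x} x∈ = there (∈-map⁺ suc (∈-elements (drop-there x∈)))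
∈-elements {p = outside ∷ p} {suc x} x∈ = ∈-map⁺ suc (∈-elements (drop-there x∈))

module Reachability (G : Graph) where
  open Graph G using (n; adj)

  private
    variable
      Z Z' X X' W W' : Subset n
      a b c : Fin n

  edge? : ∀ u v → Dec (Edge G u v)
  edge? u v = adj u v ≟ᵇ true

  source∉ : Walk G Z a b → a ∉ Z
  source∉ (here a∉)     = a∉
  source∉ (step a∉ _ _) = a∉

  target∉ : Walk G Z a b → b ∉ Z
  target∉ (here b∉)    = b∉
  target∉ (step _ _ p) = target∉ p

  walk-++ : Walk G Z a b → Walk G Z b c → Walk G Z a c
  walk-++ (here _)      q = q
  walk-++ (step a∉ e p) q = step a∉ e (walk-++ p q)

  walk-snoc : Walk G Z a b → Edge G b c → c ∉ Z → Walk G Z a c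
  walk-snoc p e c∉ = walk-++ p (step (target∉ p) e (here c∉))

  walk-mono : Z' ⊆ Z → Walk G Z a b → Walk G Z' a b
  walk-mono Z'⊆Z (here a∉)     = here (a∉ ∘ Z'⊆Z)
  walk-mono Z'⊆Z (step a∉ e p) = step (a∉ ∘ Z'⊆Z) e (walk-mono Z'⊆Z p)

  Closed : Pred (Fin n) _ → Subset n → Set
  Closed P Z = ∀ {b c} → P b → Edge G b c → c ∉ Z → P c

  walk-stays : ∀ {P} → Closed P Z → P a → Walk G Z a b → P b
  walk-stays closed pa (here _)     = pa
  walk-stays closed pa (step _ e p) = walk-stays closed (closed pa e (source∉ p)) p

  walk-confined : ∀ {P} → Closed P Z → (∀ {v} → P v → v ∉ Z') → P a → Walk G Z a b → Walk G Z' a b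
  walk-confined closed P∌ pa (here _)     = here (P∌ pa)
  walk-confined closed P∌ pa (step _ e p) =
    step (P∌ pa) e (walk-confined closed P∌ (closed pa e (source∉ p)) p)

  last-exit : ∀ x → Walk G Z a b → x ≢ b →
    Walk G (Z ∪ ⁅ x ⁆) a b ⊎ ∃ λ v → Edge G x v × Walk G (Z ∪ ⁅ x ⁆) v b
  last-exit x (here b∉) x≢b = inj₁ (here ([ b∉ , x≢b ∘ sym ]′ ∘ x∈p∪⁅y⁆⁻))
  last-exit x (step {u} u∉ e p) x≢b with last-exit x p x≢b
  ... | inj₂ later = inj₂ later
  ... | inj₁ q with u ≟ᶠ x
  ...   | yes refl = inj₂ (_ , e , q)
  ...   | no u≢x   = inj₁ (step ([ u∉ , u≢x ]′ ∘ x∈p∪⁅y⁆⁻) e q)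

  private
    walk?-acc : Acc _⊃_ Z → ∀ x y → Dec (Walk G Z x y)
    walk?-acc {Z} (acc larger) x y with x ∈? Z
    ... | yes x∈ = no λ p → source∉ p x∈
    ... | no x∉ with x ≟ᶠ y
    ...   | yes refl = yes (here x∉)
    ...   | no x≢y with any? (λ v → edge? x v ×-dec walk?-acc (larger (p⊆p∪q _ , x , x∈p∪⁅x⁆ , x∉)) v y)
    ...     | yes (v , e , q) = yes (step x∉ e (walk-mono (p⊆p∪q ⁅ x ⁆) q))
    ...     | no ¬next = no λ p → [ (λ q → source∉ q x∈p∪⁅x⁆) , ¬next ]′ (last-exit x p x≢y)

  walk? : ∀ Z x y → Dec (Walk G Z x y)
  walk? Z = walk?-acc (⊃-wellFounded Z)

  separator? : ∀ X Y W → Dec (Separator G X Y W)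
  separator? X Y W = all? λ x → all? λ y → x ∈? X →-dec (y ∈? Y →-dec ¬? (walk? W x y))

  inN? : ∀ A → Decidable (InN G A)
  inN? A v = ¬? (v ∈? A) ×-dec any? (λ a → a ∈? A ×-dec edge? a v)

  InN-closed : ∀ {A} → (∀ {v} → InN G A v → v ∈ Z) → Closed (_∈ A) Z
  InN-closed {A = A} InN⊆Z {c = c} b∈A e c∉Z with c ∈? A
  ... | yes c∈A = c∈A
  ... | no c∉A  = contradiction (InN⊆Z (c∉A , _ , b∈A , e)) c∉Z

  walk-leaves : ∀ {C} → Walk G Z a b → a ∈ C → b ∉ C → ∃ λ x → InN G C x × x ∉ Z
  walk-leaves (here _) a∈C a∉C = contradiction a∈C a∉C
  walk-leaves {C = C} (step {v = c} _ e p) a∈C b∉C with c ∈? C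
  ... | yes c∈C = walk-leaves p c∈C b∉C
  ... | no c∉C  = c , (c∉C , _ , a∈C , e) , source∉ p

  reach? : ∀ X W → Decidable (Reach G X W)
  reach? X W v = any? λ x → x ∈? X ×-dec walk? W x v

  reach : Subset n → Subset n → Subset n
  reach X W = ⟦ reach? X W ⟧

  reach-closed : Closed (Reach G X W) W
  reach-closed (x , x∈X , p) e c∉ = x , x∈X , walk-snoc p e c∉

  reach-transfer : (∀ {v} → Reach G X W v → v ∉ Z) → Reach G X W a → Reach G X Z a
  reach-transfer R∌ (x , x∈X , p) =
    x , x∈X , walk-confined reach-closed R∌ (x , x∈X , here (source∉ p)) p

  reach-mono : X ⊆ X' → Reach G X W a → Reach G X' W a
  reach-mono X⊆X' (x , x∈X , p) = x , X⊆X' x∈X , p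

  reach-absorb : Reach G X W b → Reach G (X ∪ ⁅ b ⁆) W a → Reach G X W a
  reach-absorb (x₀ , x₀∈X , q) (x , x∈ , p) with x∈p∪⁅y⁆⁻ x∈
  ... | inj₁ x∈X = x , x∈X , p
  ... | inj₂ refl = x₀ , x₀∈X , walk-++ q p

  ∈reach⁺ : Reach G X W a → a ∈ reach X W
  ∈reach⁺ {X = X} {W = W} = ∈⟦⟧⁺ (reach? X W)

  ∈reach⁻ : a ∈ reach X W → Reach G X W a
  ∈reach⁻ {X = X} {W = W} = ∈⟦⟧⁻ (reach? X W)

  separator-absorb : ∀ {Y} → Reach G X W b → Separator G X Y W → Separator G (X ∪ ⁅ b ⁆) Y W
  separator-absorb r sep x y x∈ y∈Y p =
    let (x₀ , x₀∈X , q) = reach-absorb r (x , x∈ , p) in sep x₀ y x₀∈X y∈Y q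

  separator-restrict : ∀ {Y} → X ⊆ X' → Separator G X' Y W → Separator G X Y W
  separator-restrict X⊆X' sep x y x∈X = sep x y (X⊆X' x∈X)

  reach-antimono : W' ⊆ W → Reach G X W a → Reach G X W' a
  reach-antimono W'⊆W (x , x∈X , p) = x , x∈X , walk-mono W'⊆W p

  reach-trans : (∀ {x} → x ∈ X' → Reach G X W x) → Reach G X' W a → Reach G X W a
  reach-trans X'⊆R (x , x∈X' , p) = let (x₀ , x₀∈X , q) = X'⊆R x∈X' in x₀ , x₀∈X , walk-++ q p

  separator-extend : ∀ {Y} → (∀ {x} → x ∈ X' → Reach G X W x) → Separator G X Y W → Separator G X' Y W
  separator-extend X'⊆R sep x y x∈X' y∈Y p =
    let (x₀ , x₀∈X , q) = reach-trans X'⊆R (x , x∈X' , p) in sep x₀ y x₀∈X y∈Y q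

  important-restrict : ∀ {Y} → X' ⊆ X → (∀ {x} → x ∈ X → Reach G X' W x) →
    ImportantSeparator G X Y W → ImportantSeparator G X' Y W
  important-restrict {X'} {X} {W} X'⊆X X⊆R ((sep , minimal) , important) =
    ( separator-restrict X'⊆X sep
    , λ W' W'⊂W → minimal W' W'⊂W ∘ separator-extend (reach-antimono (proj₁ W'⊂W) ∘ X⊆R) )
    , λ W' sep' ∣W'∣≤∣W∣ (grow , v , r'v , ¬rv) →
        important W' (separator-extend (grow _ ∘ X⊆R) sep') ∣W'∣≤∣W∣
          ( (λ w → reach-mono X'⊆X ∘ grow w ∘ reach-trans X⊆R) , v , reach-mono X'⊆X r'v , ¬rv ∘ reach-trans X⊆R )

module SeparatorsOver (G : Graph) (Y : Subset (Graph.n G)) where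
  open Graph G using (n)
  open Reachability G

  private
    variable
      D X X' W W' A B : Subset n
      u v : Fin n

  Disjoint : Subset n → Subset n → Set
  Disjoint A B = ∀ {v} → v ∈ A → v ∉ B

  record SepOver (D X W : Subset n) : Set where
    constructor mkSepOver
    field
      D⊆W       : D ⊆ W
      X∩W≡∅     : Disjoint X W
      separates : Separator G X Y W

  sepOver? : ∀ D X W → Dec (SepOver D X W)
  sepOver? D X W =
    map′ (λ (D⊆W , X∩W≡∅ , sep) → mkSepOver (λ {v} → D⊆W {v}) (λ {v} → X∩W≡∅ v) sep)
         (λ (mkSepOver D⊆W X∩W≡∅ sep) → (λ {v} → D⊆W {v}) , (λ v → X∩W≡∅ {v}) , sep)
         (D ⊆? W ×-dec all? (λ v → v ∈? X →-dec ¬? (v ∈? W)) ×-dec separator? X Y W)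

  record ImportantOver (D X W : Subset n) : Set where
    field
      sepOver   : SepOver D X W
      minimal   : ∀ W' → D ⊆ W' → _⊂_ G W' W → ¬ Separator G X Y W'
      important : ∀ W' → D ⊆ W' → Separator G X Y W' → ∣ W' ∣ ≤ ∣ W ∣ → ¬ StrictlyMoreReach G X W W'
    open SepOver sepOver public

  importantSeparator⇒importantOver : Disjoint X W → ImportantSeparator G X Y W → ImportantOver ⊥ X W
  importantSeparator⇒importantOver X∩W≡∅ ((sep , minimal) , important) = record
    { sepOver   = mkSepOver (⊆-min _) X∩W≡∅ sep
    ; minimal   = λ W' _ → minimal W'
    ; important = λ W' _ → important W'
    }

  record Region (D X A : Subset n) : Set where
    field
      X⊆A   : X ⊆ A
      A∩Y≡∅ : Disjoint A Y
      A∩D≡∅ : Disjoint A D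

  reach-region : SepOver D X W → Region D X (reach X W)
  reach-region (mkSepOver D⊆W X∩W≡∅ separates) = record
    { X⊆A   = λ x∈X → ∈reach⁺ (_ , x∈X , here (X∩W≡∅ x∈X))
    ; A∩Y≡∅ = λ v∈R v∈Y → let (x , x∈X , p) = ∈reach⁻ v∈R in separates x _ x∈X v∈Y p
    ; A∩D≡∅ = λ v∈R v∈D → let (_ , _ , p) = ∈reach⁻ v∈R in target∉ p (D⊆W v∈D)
    }

  region-∪ : Region D X A → Region D X B → Region D X (A ∪ B)
  region-∪ {A = A} {B} rA rB = record
    { X⊆A   = x∈p∪q⁺ ∘ inj₁ ∘ Region.X⊆A rA
    ; A∩Y≡∅ = [ Region.A∩Y≡∅ rA , Region.A∩Y≡∅ rB ]′ ∘ x∈p∪q⁻ A B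
    ; A∩D≡∅ = [ Region.A∩D≡∅ rA , Region.A∩D≡∅ rB ]′ ∘ x∈p∪q⁻ A B
    }

  region-∩ : Region D X A → Region D X B → Region D X (A ∩ B)
  region-∩ {A = A} {B} rA rB = record
    { X⊆A   = λ x∈X → x∈p∩q⁺ (Region.X⊆A rA x∈X , Region.X⊆A rB x∈X)
    ; A∩Y≡∅ = Region.A∩Y≡∅ rA ∘ proj₁ ∘ x∈p∩q⁻ A B
    ; A∩D≡∅ = Region.A∩D≡∅ rA ∘ proj₁ ∘ x∈p∩q⁻ A B
    }

  region-weaken : X ⊆ X' → Region D X' A → Region D X A
  region-weaken X⊆X' r = record
    { X⊆A = Region.X⊆A r ∘ X⊆X' ; A∩Y≡∅ = Region.A∩Y≡∅ r ; A∩D≡∅ = Region.A∩D≡∅ r }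

  boundary : Subset n → Subset n → Subset n
  boundary D A = ⟦ (λ v → v ∈? D ⊎-dec inN? A v) ⟧

  ∈boundary⁻ : v ∈ boundary D A → v ∈ D ⊎ InN G A v
  ∈boundary⁻ {D = D} {A} = ∈⟦⟧⁻ (λ v → v ∈? D ⊎-dec inN? A v)

  ∈boundary⁺ : v ∈ D ⊎ InN G A v → v ∈ boundary D A
  ∈boundary⁺ {D = D} {A} = ∈⟦⟧⁺ (λ v → v ∈? D ⊎-dec inN? A v)

  D⊆boundary : D ⊆ boundary D A
  D⊆boundary = ∈boundary⁺ ∘ inj₁

  InN⊆boundary : InN G A v → v ∈ boundary D A
  InN⊆boundary = ∈boundary⁺ ∘ inj₂

  boundary-closed : Closed (_∈ A) (boundary D A)
  boundary-closed = InN-closed InN⊆boundary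

  A∩boundary≡∅ : Disjoint A D → Disjoint A (boundary D A)
  A∩boundary≡∅ A∩D≡∅ v∈A = [ A∩D≡∅ v∈A , (λ (v∉A , _) → v∉A v∈A) ]′ ∘ ∈boundary⁻

  region⇒sepOver : Region D X A → SepOver D X (boundary D A)
  region⇒sepOver r = mkSepOver D⊆boundary (A∩boundary≡∅ (Region.A∩D≡∅ r) ∘ Region.X⊆A r)
    λ x y x∈X y∈Y p → Region.A∩Y≡∅ r (walk-stays boundary-closed (Region.X⊆A r x∈X) p) y∈Y

  boundary-reach⊆ : D ⊆ W → boundary D (reach X W) ⊆ W
  boundary-reach⊆ {W = W} D⊆W v∈∂ with ∈boundary⁻ v∈∂
  ... | inj₁ v∈D = D⊆W v∈D
  ... | inj₂ (v∉R , a , a∈R , e) with _ ∈? W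
  ...   | yes v∈W = v∈W
  ...   | no v∉W  = contradiction (∈reach⁺ (reach-closed (∈reach⁻ a∈R) e v∉W)) v∉R

  boundary-submodular : ∣ boundary D (A ∪ B) ∣ + ∣ boundary D (A ∩ B) ∣ ≤ ∣ boundary D A ∣ + ∣ boundary D B ∣
  boundary-submodular {D} {A} {B} = ∣p∣+∣q∣≤∣r∣+∣s∣ ∪⊆ ∩⊆
    where
    outside-∪ : v ∉ A ∪ B → v ∉ A × v ∉ B
    outside-∪ v∉A∪B = v∉A∪B ∘ x∈p∪q⁺ ∘ inj₁ , v∉A∪B ∘ x∈p∪q⁺ ∘ inj₂

    inN-∪ : InN G (A ∪ B) v → InN G A v ⊎ InN G B v
    inN-∪ (v∉ , a , a∈ , e) with outside-∪ v∉ | x∈p∪q⁻ A B a∈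
    ... | v∉A , _   | inj₁ a∈A = inj₁ (v∉A , a , a∈A , e)
    ... | _   , v∉B | inj₂ a∈B = inj₂ (v∉B , a , a∈B , e)

    inN-∩ : InN G (A ∩ B) v → InN G A v ⊎ InN G B v
    inN-∩ {v} (v∉ , a , a∈ , e) with v ∈? A | x∈p∩q⁻ A B a∈
    ... | no v∉A  | a∈A , _ = inj₁ (v∉A , a , a∈A , e)
    ... | yes v∈A | _ , a∈B = inj₂ ((λ v∈B → v∉ (x∈p∩q⁺ (v∈A , v∈B))) , a , a∈B , e)

    inN-∪∩ : InN G (A ∪ B) v → InN G (A ∩ B) v → InN G A v × InN G B v
    inN-∪∩ (v∉ , _) (_ , a , a∈ , e) with outside-∪ v∉ | x∈p∩q⁻ A B a∈
    ... | v∉A , v∉B | a∈A , a∈B = (v∉A , a , a∈A , e) , (v∉B , a , a∈B , e)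

    into-∪ : v ∈ D ⊎ (InN G A v ⊎ InN G B v) → v ∈ boundary D A ∪ boundary D B
    into-∪ (inj₁ v∈D)        = x∈p∪q⁺ (inj₁ (D⊆boundary v∈D))
    into-∪ (inj₂ (inj₁ inA)) = x∈p∪q⁺ (inj₁ (InN⊆boundary inA))
    into-∪ (inj₂ (inj₂ inB)) = x∈p∪q⁺ (inj₂ (InN⊆boundary inB))

    ∪⊆ : boundary D (A ∪ B) ∪ boundary D (A ∩ B) ⊆ boundary D A ∪ boundary D B
    ∪⊆ v∈ with x∈p∪q⁻ (boundary D (A ∪ B)) _ v∈
    ... | inj₁ v∈∂∪ = into-∪ (map₂ inN-∪ (∈boundary⁻ v∈∂∪))
    ... | inj₂ v∈∂∩ = into-∪ (map₂ inN-∩ (∈boundary⁻ v∈∂∩))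

    ∩⊆ : boundary D (A ∪ B) ∩ boundary D (A ∩ B) ⊆ boundary D A ∩ boundary D B
    ∩⊆ v∈ with x∈p∩q⁻ (boundary D (A ∪ B)) _ v∈
    ... | v∈∂∪ , v∈∂∩ with ∈boundary⁻ v∈∂∪ | ∈boundary⁻ v∈∂∩
    ...   | inj₁ v∈D   | _          = x∈p∩q⁺ (D⊆boundary v∈D , D⊆boundary v∈D)
    ...   | inj₂ _     | inj₁ v∈D   = x∈p∩q⁺ (D⊆boundary v∈D , D⊆boundary v∈D)
    ...   | inj₂ in∪   | inj₂ in∩   =
      let (inA , inB) = inN-∪∩ in∪ in∩ in x∈p∩q⁺ (InN⊆boundary inA , InN⊆boundary inB)

  reach-into-boundary : Region D X A → reach X W ⊆ A → Reach G X W v → Reach G X (boundary D A) v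
  reach-into-boundary rA R⊆A = reach-transfer (A∩boundary≡∅ (Region.A∩D≡∅ rA) ∘ R⊆A ∘ ∈reach⁺)

  record Minimum (D X W : Subset n) : Set where
    field
      sepOver : SepOver D X W
      minimum : ∀ {W'} → SepOver D X W' → ∣ W ∣ ≤ ∣ W' ∣

  -- Submodularity of boundary sizes, with the intersection bounded below by the minimum.
  uncross : Minimum D X W → Region D X A → ∣ boundary D (A ∪ reach X W) ∣ ≤ ∣ boundary D A ∣
  uncross {D} {X} {W} {A} min rA =
    +-cancelʳ-≤ _ _ _ (≤-trans boundary-submodular (+-monoʳ-≤ _ ∣∂R∣≤∣∂A∩R∣))
    where
    open Minimum min
    ∣∂R∣≤∣∂A∩R∣ : ∣ boundary D (reach X W) ∣ ≤ ∣ boundary D (A ∩ reach X W) ∣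
    ∣∂R∣≤∣∂A∩R∣ = ≤-trans (p⊆q⇒∣p∣≤∣q∣ (boundary-reach⊆ (SepOver.D⊆W sepOver)))
                          (minimum (region⇒sepOver (region-∩ rA (reach-region sepOver))))

  minimum-reach⊆important-reach : Minimum D X W' → ImportantOver D X W → Reach G X W' v → Reach G X W v
  minimum-reach⊆important-reach {D} {X} {W'} {W} {v} min imp r' with reach? X W v
  ... | yes r = r
  ... | no ¬r = contradiction
                  ((λ _ → reach-into-boundary rA (x∈p∪q⁺ ∘ inj₁)) , v , reach-into-boundary rA (x∈p∪q⁺ ∘ inj₂) r' , ¬r)
                  (important Z (SepOver.D⊆W sepZ) (SepOver.separates sepZ) ∣Z∣≤∣W∣)
    where
    open ImportantOver imp
    rA = region-∪ (reach-region sepOver) (reach-region (Minimum.sepOver min))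
    Z = boundary D (reach X W ∪ reach X W')
    sepZ = region⇒sepOver rA
    ∣Z∣≤∣W∣ : ∣ Z ∣ ≤ ∣ W ∣
    ∣Z∣≤∣W∣ = ≤-trans (uncross min (reach-region sepOver)) (p⊆q⇒∣p∣≤∣q∣ (boundary-reach⊆ D⊆W))

  record FurthestMinimum (D X W : Subset n) : Set where
    field
      isMinimum : Minimum D X W
      furthest  : ∀ {W'} → SepOver D X W' → ∣ W' ∣ ≤ ∣ W ∣ → ∣ reach X W' ∣ ≤ ∣ reach X W ∣
    open Minimum isMinimum public

  furthestMinimum : SepOver D X W' → ∃ (FurthestMinimum D X)
  furthestMinimum {D} {X} s₀ with minimum-by (sepOver? D X) ∣_∣ s₀
  ... | W , sW , least
    with maximum-by (λ W' → sepOver? D X W' ×-dec ∣ W' ∣ ≤? ∣ W ∣) (∣_∣ ∘ reach X) (∣p∣≤n ∘ reach X) (sW , ≤-refl)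
  ...   | Wf , (sWf , ∣Wf∣≤∣W∣) , furthest = Wf , record
    { isMinimum = record { sepOver = sWf ; minimum = λ s → ≤-trans ∣Wf∣≤∣W∣ (least _ s) }
    ; furthest  = λ s ∣W'∣≤∣Wf∣ → furthest _ (s , ≤-trans ∣W'∣≤∣Wf∣ ∣Wf∣≤∣W∣)
    }

  beyond-furthestMinimum : FurthestMinimum D X W → InN G (reach X W) u → SepOver D (X ∪ ⁅ u ⁆) W' → ∣ W ∣ < ∣ W' ∣
  beyond-furthestMinimum {D} {X} {W} {u} {W'} fm (u∉R , a , a∈R , e) s' with ∣ W ∣ <? ∣ W' ∣
  ... | yes lt = lt
  ... | no ≮ = contradiction (furthest (region⇒sepOver rA) ∣Z∣≤∣W∣) (<⇒≱ R⊂reachZ)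
    where
    open FurthestMinimum fm
    X⊆X∪u : X ⊆ X ∪ ⁅ u ⁆
    X⊆X∪u = p⊆p∪q ⁅ u ⁆
    R' = reach (X ∪ ⁅ u ⁆) W'
    rR' = region-weaken X⊆X∪u (reach-region s')
    U = R' ∪ reach X W
    rA = region-∪ rR' (reach-region sepOver)
    ∣Z∣≤∣W∣ : ∣ boundary D U ∣ ≤ ∣ W ∣
    ∣Z∣≤∣W∣ = ≤-trans (uncross isMinimum rR')
                (≤-trans (p⊆q⇒∣p∣≤∣q∣ (boundary-reach⊆ (SepOver.D⊆W s'))) (≮⇒≥ ≮))
    into-Z : Reach G X W v → Reach G X (boundary D U) v
    into-Z = reach-into-boundary rA (x∈p∪q⁺ ∘ inj₂)
    u∈U : u ∈ U
    u∈U = x∈p∪q⁺ (inj₁ (∈reach⁺ (u , x∈p∪⁅x⁆ , here (SepOver.X∩W≡∅ s' x∈p∪⁅x⁆))))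
    R⊂reachZ : ∣ reach X W ∣ < ∣ reach X (boundary D U) ∣
    R⊂reachZ = p⊂q⇒∣p∣<∣q∣ ( ∈reach⁺ ∘ into-Z ∘ ∈reach⁻
                          , u , ∈reach⁺ (reach-closed (into-Z (∈reach⁻ a∈R)) e
                                          (A∩boundary≡∅ (Region.A∩D≡∅ rA) u∈U))
                          , u∉R )

  unforced-neighbour : SepOver D X W → ¬ Separator G X Y D → ∃ λ u → InN G (reach X W) u × u ∉ D
  unforced-neighbour {D} {X} {W} s ¬D-sep with any? (λ u → inN? (reach X W) u ×-dec ¬? (u ∈? D))
  ... | yes found = found
  ... | no none = contradiction D-sep ¬D-sep
    where
    open Region (reach-region s)
    InN⊆D : ∀ {c} → InN G (reach X W) c → c ∈ D
    InN⊆D {c} inN with c ∈? D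
    ... | yes c∈D = c∈D
    ... | no c∉D  = contradiction (c , inN , c∉D) none
    D-sep : Separator G X Y D
    D-sep x y x∈X y∈Y p = A∩Y≡∅ (walk-stays (InN-closed InN⊆D) (X⊆A x∈X) p) y∈Y

  important-forced : ImportantOver D X W → u ∈ W → ImportantOver (D ∪ ⁅ u ⁆) X W
  important-forced {D = D} {W = W} {u = u} imp u∈W = record
    { sepOver   = mkSepOver D∪u⊆W X∩W≡∅ separates
    ; minimal   = λ W' D∪u⊆W' → minimal W' (D∪u⊆W' ∘ D⊆D∪u)
    ; important = λ W' D∪u⊆W' → important W' (D∪u⊆W' ∘ D⊆D∪u)
    }
    where
    open ImportantOver imp
    D⊆D∪u : D ⊆ D ∪ ⁅ u ⁆
    D⊆D∪u = p⊆p∪q ⁅ u ⁆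
    D∪u⊆W : D ∪ ⁅ u ⁆ ⊆ W
    D∪u⊆W = [ D⊆W , (λ { refl → u∈W }) ]′ ∘ x∈p∪⁅y⁆⁻

  important-source : ImportantOver D X W → Reach G X W u → u ∉ W → ImportantOver D (X ∪ ⁅ u ⁆) W
  important-source {D} {X} {W} {u} imp r u∉W = record
    { sepOver   = mkSepOver D⊆W X∪u∩W≡∅ (separator-absorb r separates)
    ; minimal   = λ W' D⊆W' W'⊂W → minimal W' D⊆W' W'⊂W ∘ separator-restrict X⊆X∪u
    ; important = important′
    }
    where
    open ImportantOver imp
    X⊆X∪u : X ⊆ X ∪ ⁅ u ⁆
    X⊆X∪u = p⊆p∪q ⁅ u ⁆
    X∪u∩W≡∅ : Disjoint (X ∪ ⁅ u ⁆) W
    X∪u∩W≡∅ = [ X∩W≡∅ , (λ { refl → u∉W }) ]′ ∘ x∈p∪⁅y⁆⁻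
    important′ : ∀ W' → D ⊆ W' → Separator G (X ∪ ⁅ u ⁆) Y W' → ∣ W' ∣ ≤ ∣ W ∣ →
                 ¬ StrictlyMoreReach G (X ∪ ⁅ u ⁆) W W'
    important′ W' D⊆W' sep' ∣W'∣≤∣W∣ (grow , v , r'v , ¬rv) =
      important W' D⊆W' (separator-restrict X⊆X∪u sep') ∣W'∣≤∣W∣
        ((λ w → reach-absorb r' ∘ grow w ∘ reach-mono X⊆X∪u) , v , reach-absorb r' r'v , ¬rv ∘ reach-mono X⊆X∪u)
      where
      r' : Reach G X W' u
      r' = reach-transfer (λ rw → let (_ , _ , p) = grow _ (reach-mono X⊆X∪u rw) in target∉ p) r

  important≡forced : Separator G X Y D → ImportantOver D X W → W ≡ D
  important≡forced {X} {D} {W} D-sep imp with ≡-dec _≟ᵇ_ D W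
  ... | yes D≡W = sym D≡W
  ... | no D≢W  = contradiction D-sep (ImportantOver.minimal imp D id (ImportantOver.D⊆W imp , D≢W))

  forced<important : ¬ Separator G X Y D → ImportantOver D X W → ∣ D ∣ < ∣ W ∣
  forced<important ¬D-sep imp =
    p⊆q∧p≢q⇒∣p∣<∣q∣ (ImportantOver.D⊆W imp) λ { refl → ¬D-sep (ImportantOver.separates imp) }

  module _ (b : ℕ) where

    Candidate : Subset n → Subset n → Subset n → Set
    Candidate D X W = ImportantOver D X W × ∣ W ∣ ≤ b

    -- The budget m bounds 2b − λ − |D|, where λ is the least size of a separator over D.
    Budget : ℕ → Subset n → Subset n → Set
    Budget m D X = ∀ {W} → SepOver D X W → 2 * b ≤ m + ∣ W ∣ + ∣ D ∣

    important-count : ∀ m D X → Budget m D X →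
      ∀ {Ws} → Unique Ws → All (Candidate D X) Ws → length Ws ≤ 2 ^ m

    private
      count-unseparated : ∀ m D X → ¬ Separator G X Y D → Budget m D X →
        ∀ {Ws} → Unique Ws → All (Candidate D X) Ws → length Ws ≤ 2 ^ m
      count-branching : ∀ m D X {Wf v} → Budget (suc m) D X →
        FurthestMinimum D X Wf → InN G (reach X Wf) v → v ∉ D →
        ∀ {Ws} → Unique Ws → All (Candidate D X) Ws → length Ws ≤ 2 ^ suc m

    important-count m D X budget u all with separator? X Y D
    ... | yes D-sep = ≤-trans (Unique∧All≡⇒length≤1 u (All.map (important≡forced D-sep ∘ proj₁) all)) (m^n>0 2 m)
    ... | no ¬D-sep = count-unseparated m D X ¬D-sep budget u all

    count-unseparated m D X ¬D-sep budget {[]} _ _ = z≤n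
    count-unseparated zero D X ¬D-sep budget {W ∷ _} _ ((imp , ∣W∣≤b) ∷ _) =
      contradiction (budget (ImportantOver.sepOver imp))
        (<⇒≱ (+-mono-≤-< ∣W∣≤b (<-≤-trans (forced<important ¬D-sep imp) (≤-trans ∣W∣≤b (m≤m+n b 0)))))
    count-unseparated (suc m) D X ¬D-sep budget {W ∷ _} u all@((imp , _) ∷ _) =
      let Wf , fm       = furthestMinimum (ImportantOver.sepOver imp)
          v , inN , v∉D = unforced-neighbour (FurthestMinimum.sepOver fm) ¬D-sep
      in count-branching m D X budget fm inN v∉D u all

    count-branching m D X {Wf} {v} budget fm inN@(_ , a , a∈R , e) v∉D {Ws} u all =
      subst (_≤ 2 ^ suc m) (length-filter+length-filter-∁ (v ∈?_) Ws)
        (+-mono-≤ (important-count m (D ∪ ⁅ v ⁆) X budget-forced (Unique-filter⁺ (v ∈?_) u)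
                     (All.map toForced (all-filter-× (v ∈?_) all)))
                  (≤-trans (important-count m D (X ∪ ⁅ v ⁆) budget-source (Unique-filter⁺ (∁? (v ∈?_)) u)
                              (All.map toSource (all-filter-× (∁? (v ∈?_)) all)))
                           (≤-reflexive (sym (+-identityʳ (2 ^ m))))))
      where
      D⊆D∪v : D ⊆ D ∪ ⁅ v ⁆
      D⊆D∪v = p⊆p∪q ⁅ v ⁆

      budget-forced : Budget m (D ∪ ⁅ v ⁆) X
      budget-forced {W} (mkSepOver D∪v⊆W X∩W≡∅ sep) =
        ≤-trans (budget (mkSepOver (D∪v⊆W ∘ D⊆D∪v) X∩W≡∅ sep))
          (≤-trans (≤-reflexive (sym (+-suc (m + ∣ W ∣) ∣ D ∣)))
            (+-monoʳ-≤ (m + ∣ W ∣) (p⊂q⇒∣p∣<∣q∣ (D⊆D∪v , v , x∈p∪⁅x⁆ , v∉D))))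

      budget-source : Budget m D (X ∪ ⁅ v ⁆)
      budget-source s =
        ≤-trans (budget (FurthestMinimum.sepOver fm))
          (+-monoˡ-≤ ∣ D ∣ (≤-trans (≤-reflexive (sym (+-suc m ∣ Wf ∣)))
                                    (+-monoʳ-≤ m (beyond-furthestMinimum fm inN s))))

      toForced : ∀ {W} → Candidate D X W × v ∈ W → Candidate (D ∪ ⁅ v ⁆) X W
      toForced ((imp , ∣W∣≤b) , v∈W) = important-forced imp v∈W , ∣W∣≤b

      toSource : ∀ {W} → Candidate D X W × v ∉ W → Candidate D (X ∪ ⁅ v ⁆) W
      toSource ((imp , ∣W∣≤b) , v∉W) =
        important-source imp (reach-closed (reach⊆ (∈reach⁻ a∈R)) e v∉W) v∉W , ∣W∣≤b
        where reach⊆ = minimum-reach⊆important-reach (FurthestMinimum.isMinimum fm) imp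

module Chips (G : Graph) (S : Subset (Graph.n G)) (k : ℕ) where
  open Graph G using (n)
  open Reachability G
  open SeparatorsOver G S

  private
    variable
      C C' W : Subset n
      v : Fin n

  nbhd : Subset n → Subset n
  nbhd C = ⟦ inN? C ⟧

  nbhd-isNbhd : ∀ C → IsNbhd G C (nbhd C)
  nbhd-isNbhd C v = ∈⟦⟧⁻ (inN? C) , ∈⟦⟧⁺ (inN? C)

  C∩nbhd≡∅ : Disjoint C (nbhd C)
  C∩nbhd≡∅ {C} v∈C v∈N = proj₁ (∈⟦⟧⁻ (inN? C) v∈N) v∈C

  connected-walk : Connected G C → Disjoint C W → ∀ {x y} → x ∈ C → y ∈ C → Walk G W x y
  connected-walk (_ , walks) C∩W≡∅ x∈C y∈C =
    walk-mono (λ v∈W → x∉p⇒x∈∁p (λ v∈C → C∩W≡∅ v∈C v∈W)) (walks _ _ x∈C y∈C)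

  ∈⇒reach : Connected G C → v ∈ C → ∀ {x} → x ∈ C → Reach G ⁅ v ⁆ (nbhd C) x
  ∈⇒reach conn v∈C x∈C = _ , x∈⁅x⁆ _ , connected-walk conn C∩nbhd≡∅ v∈C x∈C

  reach⇒∈ : ∀ {C v} → v ∈ C → ∀ {x} → Reach G ⁅ v ⁆ (nbhd C) x → x ∈ C
  reach⇒∈ {C} {v} v∈C (u , u∈⁅v⁆ , p) with x∈⁅y⁆⇒x≡y v u∈⁅v⁆
  ... | refl = walk-stays (InN-closed (∈⟦⟧⁺ (inN? C))) v∈C p

  nbhd-injective : Connected G C → Connected G C' → v ∈ C → v ∈ C' → nbhd C ≡ nbhd C' → C ≡ C'
  nbhd-injective {v = v} conn conn' v∈C v∈C' N≡N' = ⊆-antisym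
    (reach⇒∈ v∈C' ∘ subst (λ N → Reach G ⁅ v ⁆ N _) N≡N' ∘ ∈⇒reach conn v∈C)
    (reach⇒∈ v∈C ∘ subst (λ N → Reach G ⁅ v ⁆ N _) (sym N≡N') ∘ ∈⇒reach conn' v∈C')

  ∣nbhd∣≤3k : Chip G S k C → ∣ nbhd C ∣ ≤ 3 * k
  ∣nbhd∣≤3k {C} (_ , nbhd-important) = proj₁ (nbhd-important (nbhd C) (nbhd-isNbhd C))

  chip-candidate : Chip G S k C → v ∈ C → Candidate (3 * k) ⊥ ⁅ v ⁆ (nbhd C)
  chip-candidate {C} {v} chip@(conn , nbhd-important) v∈C =
    importantSeparator⇒importantOver v∉N (important-restrict ⁅v⁆⊆C (∈⇒reach conn v∈C) imp) , ∣nbhd∣≤3k chip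
    where
    imp = proj₂ (nbhd-important (nbhd C) (nbhd-isNbhd C))
    ⁅v⁆⊆C : ⁅ v ⁆ ⊆ C
    ⁅v⁆⊆C x∈⁅v⁆ = subst (_∈ C) (sym (x∈⁅y⁆⇒x≡y v x∈⁅v⁆)) v∈C
    v∉N : Disjoint ⁅ v ⁆ (nbhd C)
    v∉N = C∩nbhd≡∅ ∘ ⁅v⁆⊆C

  chips-through-vertex : ∀ v {Cs} → Unique Cs → All (λ C → Chip G S k C × v ∈ C) Cs → length Cs ≤ 4 ^ (3 * k)
  chips-through-vertex v {Cs} u all =
    subst₂ _≤_ (length-map nbhd Cs) (sym (^-*-assoc 2 2 (3 * k)))
      (important-count (3 * k) (2 * (3 * k)) ⊥ ⁅ v ⁆ (λ {W} _ → ≤-trans (m≤m+n _ ∣ W ∣) (m≤m+n _ _))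
        (Unique-map⁺-on (λ (chip , v∈C) (chip' , v∈C') → nbhd-injective (proj₁ chip) (proj₁ chip') v∈C v∈C') all u)
        (All-map⁺ (All.map (λ (chip , v∈C) → chip-candidate chip v∈C) all)))

  maximal-chip-⊈ : Chip G S k C → MaximalChip G S k C' → C ≢ C' → ∃ λ w → w ∈ C' × w ∉ C
  maximal-chip-⊈ {C} chip (_ , maximal') C≢C' = p⊈q⇒∃∉ λ C'⊆C → C≢C' (sym (maximal' C chip C'⊆C))

  common-meets-nbhd : Connected G C' → v ∈ C → v ∈ C' → (∃ λ w → w ∈ C' × w ∉ C) → ∃ λ y → y ∈ nbhd C × y ∈ C'
  common-meets-nbhd {C = C} (_ , walks) v∈C v∈C' (w , w∈C' , w∉C) =
    let y , inN , y∉∁C' = walk-leaves (walks _ _ v∈C' w∈C') v∈C w∉C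
    in y , ∈⟦⟧⁺ (inN? C) inN , x∉∁p⇒x∈p y∉∁C'

  touching-meets-nbhd : Chip G S k C → MaximalChip G S k C' → Touch G C C' → ∃ λ y → y ∈ nbhd C × y ∈ C'
  touching-meets-nbhd chip maximal (C≢C' , inj₁ (x , x∈C , x∈C')) =
    common-meets-nbhd (proj₁ (proj₁ maximal)) x∈C x∈C' (maximal-chip-⊈ chip maximal C≢C')
  touching-meets-nbhd {C} chip maximal (C≢C' , inj₂ (u , x , u∈C , x∈C' , e)) with x ∈? C
  ... | yes x∈C = common-meets-nbhd (proj₁ (proj₁ maximal)) x∈C x∈C' (maximal-chip-⊈ chip maximal C≢C')
  ... | no x∉C  = x , ∈⟦⟧⁺ (inN? C) (x∉C , u , u∈C , e) , x∈C'

lemma6 : (G : Graph) (k : ℕ) (S C : Subset (Graph.n G)) →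
    MaximalChip G S k C →
    (Cs : List (Subset (Graph.n G))) → Unique Cs →
    All (λ C' → MaximalChip G S k C' × Touch G C C') Cs →
    length Cs ≤ 3 * k * 4 ^ (3 * k)
lemma6 G k S C (chip , _) Cs unique touching =
  ≤-trans (length≤covering*bound (λ C' v → v ∈? C')
             (λ v u maximal∋v → chips-through-vertex v u (All.map (map₁ proj₁) maximal∋v))
             (elements (nbhd C)) unique (All.map meets touching))
          (*-monoˡ-≤ (4 ^ (3 * k)) (≤-trans (≤-reflexive (length-elements (nbhd C))) (∣nbhd∣≤3k chip)))
  where
  open Chips G S k
  meets : ∀ {C'} → MaximalChip G S k C' × Touch G C C' → MaximalChip G S k C' × Any (_∈ C') (elements (nbhd C))
  meets (maximal , touch) =
    let y , y∈N , y∈C' = touching-meets-nbhd chip maximal touch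
    in maximal , Any.map (λ { refl → y∈C' }) (∈-elements y∈N)
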